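{- Let $H=(V,E)$ be a $k$-uniform hypergraph and let $\mathcal{S}$ be the family of all its exact covers. Let $f:E\to\mathbb{Z}_{>0}$ be any function and let $m$ be a positive integer. Then for every subset $U\subseteq V$, in the polynomial ring over $\mathrm{GF}(2^m)$ in the variables $\{v_e\}_{e\in E}$, $$\sum_{X\subseteq V\setminus U} W_{2,f}(H,U,X)=\sum_{E'\in\mathcal{S}}\prod_{e\in E'}v_e^{f(e)},$$ where $$W_{2,f}(H,U,X)=\sum_{E''}\prod_{e\in E''}v_e^{f(e)},$$ the sum ranging over all $E''\subseteq E$ satisfying: (Avoidance) $e\cap X=\emptyset$ for all $e\in E''$; (Cardinality) $|E''|=|V|/k$; (Coverage) $U\subseteq\bigcup_{e\in E''}e$; (Disjointness) $e_1\cap e_2\cap U=\emptyset$ for all distinct $e_1,e_2\in E''$.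
   Context: A hypergraph $H=(V,E)$ consists of a vertex set $V$ and a multiset $E$ of edges (subsets of $V$); it is $k$-uniform if every edge has exactly $k$ vertices. Subsets of $E$ are sub-multisets, i.e. distinct occurrences of an edge are distinct elements. An exact cover is a subset $E'\subseteq E$ of pairwise disjoint edges whose union is $V$. To each edge $e\in E$ (each occurrence) a distinct formal variable $v_e$ is associated. -}

module Defs where

open import Level using (Level)
open import Data.Nat using (ℕ; zero; suc) renaming (_*_ to _*ℕ_)
open import Data.Fin using (Fin)
import Data.Fin as Fin
open import Data.Fin.Properties using (all?; any?; _≟_)
open import Data.Fin.Subset using (Subset; _∈_; _∩_; Empty; Nonempty; ∣_∣; ∁; _⊆_; outside; inside)
open import Data.Fin.Subset.Properties using (_∈?_; nonempty?)
open import Data.Vec using ([]; _∷_)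
open import Data.Product using (Σ; _×_; _,_)
open import Relation.Nullary using (Dec; yes; no; ¬_)
open import Relation.Nullary.Decidable using (_→-dec_; _×-dec_; ¬?)
open import Relation.Unary using (Pred; Decidable)
open import Relation.Binary.PropositionalEquality using (_≡_; _≢_)
open import Data.Nat.Properties using () renaming (_≟_ to _≟ℕ_)
open import Algebra.Bundles using (CommutativeRing)

-- A hypergraph with vertex set V = Fin n and an indexed family of
-- M edges (index i is the i-th occurrence, so E is a multiset).
record Hypergraph (n M : ℕ) : Set where
  field
    edge : Fin M → Subset n

open Hypergraph public

Uniform : ∀ {n M} → ℕ → Hypergraph n M → Set
Uniform k H = ∀ i → ∣ edge H i ∣ ≡ k

IsExactCover : ∀ {n M} → Hypergraph n M → Subset M → Set
IsExactCover H E′ =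
  (∀ e₁ e₂ → e₁ ∈ E′ → e₂ ∈ E′ → e₁ ≢ e₂ → Empty (edge H e₁ ∩ edge H e₂))
  × (∀ v → Σ (Fin _) λ e → e ∈ E′ × v ∈ edge H e)

Avoidance : ∀ {n M} → Hypergraph n M → Subset n → Subset M → Set
Avoidance H X E″ = ∀ e → e ∈ E″ → Empty (edge H e ∩ X)

-- |E''| = |V| / k, written as |E''| * k = |V|.
Cardinality : ∀ {n M} → ℕ → Hypergraph n M → Subset M → Set
Cardinality {n} k H E″ = ∣ E″ ∣ *ℕ k ≡ n

Coverage : ∀ {n M} → Hypergraph n M → Subset n → Subset M → Set
Coverage H U E″ = ∀ u → u ∈ U → Σ (Fin _) λ e → e ∈ E″ × u ∈ edge H e

Disjointness : ∀ {n M} → Hypergraph n M → Subset n → Subset M → Set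
Disjointness H U E″ =
  ∀ e₁ e₂ → e₁ ∈ E″ → e₂ ∈ E″ → e₁ ≢ e₂ → Empty ((edge H e₁ ∩ edge H e₂) ∩ U)

W-cond : ∀ {n M} → ℕ → Hypergraph n M → Subset n → Subset n → Subset M → Set
W-cond k H U X E″ =
  Avoidance H X E″ × Cardinality k H E″ × Coverage H U E″ × Disjointness H U E″

private
  empty? : ∀ {n} (p : Subset n) → Dec (Empty p)
  empty? p = ¬? (nonempty? p)

exactCover? : ∀ {n M} (H : Hypergraph n M) → Decidable (IsExactCover H)
exactCover? H E′ =
  all? (λ e₁ → all? λ e₂ → (e₁ ∈? E′) →-dec ((e₂ ∈? E′) →-dec
    (¬? (e₁ ≟ e₂) →-dec empty? (edge H e₁ ∩ edge H e₂))))
  ×-dec all? (λ v → any? λ e → (e ∈? E′) ×-dec (v ∈? edge H e))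

W-cond? : ∀ {n M} k (H : Hypergraph n M) U X → Decidable (W-cond k H U X)
W-cond? {n} k H U X E″ =
  all? (λ e → (e ∈? E″) →-dec empty? (edge H e ∩ X))
  ×-dec ((∣ E″ ∣ *ℕ k ≟ℕ n)
  ×-dec (all? (λ u → (u ∈? U) →-dec any? λ e → (e ∈? E″) ×-dec (u ∈? edge H e))
  ×-dec all? (λ e₁ → all? λ e₂ → (e₁ ∈? E″) →-dec ((e₂ ∈? E″) →-dec
    (¬? (e₁ ≟ e₂) →-dec empty? ((edge H e₁ ∩ edge H e₂) ∩ U))))))

module RingSums {c ℓ : Level} (R : CommutativeRing c ℓ) where
  open CommutativeRing R

  pow : Carrier → ℕ → Carrier
  pow x zero = 1#
  pow x (suc j) = x * pow x j

  sumAll : ∀ {m} → (Subset m → Carrier) → Carrier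
  sumAll {zero} g = g []
  sumAll {suc m} g = sumAll (λ s → g (outside ∷ s)) + sumAll (λ s → g (inside ∷ s))

  sumWhere : ∀ {m} {a} {P : Pred (Subset m) a} → Decidable P → (Subset m → Carrier) → Carrier
  sumWhere P? g = sumAll λ s → select (P? s) (g s)
    where
    select : ∀ {b} {B : Set b} → Dec B → Carrier → Carrier
    select (yes _) x = x
    select (no _) _ = 0#

  sumSubsetsOf : ∀ {m} → Subset m → (Subset m → Carrier) → Carrier
  sumSubsetsOf A g = sumWhere (λ s → s ⊆? A) g
    where open import Data.Fin.Subset.Properties using (_⊆?_)

  prodSub : ∀ {m} → Subset m → (Fin m → Carrier) → Carrier
  prodSub [] w = 1#
  prodSub (outside ∷ s) w = prodSub s (λ i → w (Fin.suc i))
  prodSub (inside ∷ s) w = w Fin.zero * prodSub s (λ i → w (Fin.suc i))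

  monomial : ∀ {M} → (Fin M → Carrier) → (Fin M → ℕ) → Subset M → Carrier
  monomial v f E′ = prodSub E′ (λ e → pow (v e) (f e))

  W₂ : ∀ {n M} → ℕ → Hypergraph n M → (Fin M → Carrier) → (Fin M → ℕ)
       → Subset n → Subset n → Carrier
  W₂ k H v f U X = sumWhere (W-cond? k H U X) (monomial v f)

  Char2 : Set ℓ
  Char2 = 1# + 1# ≈ 0#

-- Expand each W_{2,f}(H,U,X) as a sum over edge sets E and exchange the
-- sums over X and E.  For fixed E the condition W-cond(X,E) splits into a part
-- Rest(E) independent of X (Cardinality, Coverage, Disjointness) and Avoidance,
-- which for X ⊆ V∖U says that every vertex of X is free: outside U and in no edge
-- of E.  Hence the inner sum is [Rest E] · Σ_{X ⊆ Free} m(E), and in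
-- characteristic 2 a sum Σ_{X ⊆ Q} x equals [Q = ∅]·x.  Finally, Rest(E) with no
-- free vertex means exactly that E is an exact cover: E then covers V, and by
-- double counting Σ_v deg(v) = |E|·k = |V|, so no vertex lies in two edges.
module Submission where

open import Defs
open import Level using (Level; 0ℓ)
open import Data.Nat using (ℕ; _≤_)
open import Data.Fin using (Fin)
open import Data.Fin.Subset using (Subset; ∁)
open import Algebra.Bundles using (CommutativeRing)

open import Data.Nat using (zero; suc; _+_; _*_; s≤s; z≤n)
import Data.Nat.Properties as ℕP
open import Data.Bool.Base using (if_then_else_)
open import Data.Fin.Properties using (0≢1+n; suc-injective; any?; all?) renaming (_≟_ to _≟ᶠ_)
open import Data.Vec using ([]; _∷_; here; there)
open import Data.Fin.Subset using (_∈_; _∉_; _∩_; _⊆_; Empty; ∣_∣; inside; outside; ⊥)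
open import Data.Fin.Subset.Properties
  using (_∈?_; _⊆?_; drop-there; x∈p∩q⁺; x∈p∩q⁻; x∈∁p⇒x∉p; x∉p⇒x∈∁p; ∉⊥)
open import Data.Product using (Σ; _×_; _,_; proj₁; proj₂)
open import Data.Empty using (⊥-elim)
open import Function.Bundles using (_⇔_; mk⇔; Equivalence)
open import Relation.Nullary using (Dec; yes; no; ¬_; does)
open import Relation.Nullary.Decidable using (_×-dec_; _→-dec_; ¬?; map′; decidable-stable)
open import Relation.Unary using (Pred; Decidable)
open import Relation.Binary.PropositionalEquality
  using (_≡_; _≢_; refl; sym; trans; cong; cong₂; subst; module ≡-Reasoning)
open import Algebra.Properties.Semiring.Sum ℕP.+-*-semiring
  using (sum; sum-syntax; ∑-comm; *-distribˡ-sum; *-distribʳ-sum; sum-cong-≗; sum-replicate-zero)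

private variable
  a b c′ d′ : Level
  n : ℕ

𝟙 : {A : Set a} → Dec A → ℕ
𝟙 d = if does d then 1 else 0

𝟙-yes : {A : Set a} (d : Dec A) → A → 𝟙 d ≡ 1
𝟙-yes (yes _) _ = refl
𝟙-yes (no ¬a) a = ⊥-elim (¬a a)

𝟙-no : {A : Set a} (d : Dec A) → ¬ A → 𝟙 d ≡ 0
𝟙-no (yes a) ¬a = ⊥-elim (¬a a)
𝟙-no (no _) _ = refl

𝟙-× : {A : Set a} {B : Set b} (d : Dec A) (e : Dec B) → 𝟙 (d ×-dec e) ≡ 𝟙 d * 𝟙 e
𝟙-× (yes _) e = sym (ℕP.+-identityʳ (𝟙 e))
𝟙-× (no _) e = refl

count : {P : Pred (Fin n) a} → Decidable P → ℕ
count {n = n} P? = ∑[ i < n ] 𝟙 (P? i)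

∣p∣≡count : (p : Subset n) → ∣ p ∣ ≡ count (_∈? p)
∣p∣≡count [] = refl
∣p∣≡count (inside ∷ p) = cong suc (∣p∣≡count p)
∣p∣≡count (outside ∷ p) = ∣p∣≡count p

sum-pos : (g : Fin n → ℕ) → (∀ i → 1 ≤ g i) → n ≤ sum g
sum-pos {zero} g pos = z≤n
sum-pos {suc n} g pos = ℕP.+-mono-≤ (pos Fin.zero) (sum-pos (λ i → g (Fin.suc i)) (λ i → pos (Fin.suc i)))

sum-excess : (g : Fin n → ℕ) → (∀ i → 1 ≤ g i) → ∀ j → 2 ≤ g j → suc n ≤ sum g
sum-excess g pos Fin.zero two = ℕP.+-mono-≤ two (sum-pos (λ i → g (Fin.suc i)) (λ i → pos (Fin.suc i)))
sum-excess g pos (Fin.suc j) two =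
  ℕP.+-mono-≤ (pos Fin.zero) (sum-excess (λ i → g (Fin.suc i)) (λ i → pos (Fin.suc i)) j two)

sum-ones : (g : Fin n → ℕ) → (∀ i → g i ≡ 1) → sum g ≡ n
sum-ones {zero} g one = refl
sum-ones {suc n} g one = cong₂ _+_ (one Fin.zero) (sum-ones (λ i → g (Fin.suc i)) (λ i → one (Fin.suc i)))

count-none : {P : Pred (Fin n) a} (P? : Decidable P) → (∀ i → ¬ P i) → count P? ≡ 0
count-none {n = n} P? none = trans (sum-cong-≗ (λ i → 𝟙-no (P? i) (none i))) (sum-replicate-zero n)

count-≥1 : {P : Pred (Fin n) a} (P? : Decidable P) → ∀ i → P i → 1 ≤ count P?
count-≥1 P? Fin.zero p rewrite 𝟙-yes (P? Fin.zero) p = s≤s z≤n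
count-≥1 P? (Fin.suc i) p = ℕP.≤-trans (count-≥1 (λ j → P? (Fin.suc j)) i p) (ℕP.m≤n+m _ _)

count-≥2 : {P : Pred (Fin n) a} (P? : Decidable P) → ∀ i j → i ≢ j → P i → P j → 2 ≤ count P?
count-≥2 P? Fin.zero Fin.zero i≢j _ _ = ⊥-elim (i≢j refl)
count-≥2 P? Fin.zero (Fin.suc j) _ p q rewrite 𝟙-yes (P? Fin.zero) p =
  s≤s (count-≥1 (λ l → P? (Fin.suc l)) j q)
count-≥2 P? (Fin.suc i) Fin.zero _ p q rewrite 𝟙-yes (P? Fin.zero) q =
  s≤s (count-≥1 (λ l → P? (Fin.suc l)) i p)
count-≥2 P? (Fin.suc i) (Fin.suc j) i≢j p q =
  ℕP.≤-trans (count-≥2 (λ l → P? (Fin.suc l)) i j (λ eq → i≢j (cong Fin.suc eq)) p q) (ℕP.m≤n+m _ _)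

count-≤1 : {P : Pred (Fin n) a} (P? : Decidable P) → (∀ i j → P i → P j → i ≡ j) → count P? ≤ 1
count-≤1 {n = zero} P? unique = z≤n
count-≤1 {n = suc n} P? unique with P? Fin.zero
... | yes p = ℕP.≤-reflexive (cong suc (count-none (λ i → P? (Fin.suc i)) (λ i q → 0≢1+n (unique _ _ p q))))
... | no _ = count-≤1 (λ i → P? (Fin.suc i)) (λ i j p q → suc-injective (unique _ _ p q))

_⊆ᴾ_ : Subset n → Pred (Fin n) a → Set a
X ⊆ᴾ Q = ∀ v → v ∈ X → Q v

_⊆ᴾ?_ : {Q : Pred (Fin n) a} (X : Subset n) → Decidable Q → Dec (X ⊆ᴾ Q)
X ⊆ᴾ? Q? = all? (λ v → (v ∈? X) →-dec Q? v)

outside-⊆ᴾ : {Q : Pred (Fin (suc n)) a} (X : Subset n) → (outside ∷ X) ⊆ᴾ Q ⇔ X ⊆ᴾ (λ v → Q (Fin.suc v))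
outside-⊆ᴾ X = mk⇔ (λ sub v v∈X → sub (Fin.suc v) (there v∈X))
                   (λ { sub Fin.zero () ; sub (Fin.suc v) v∈ → sub v (drop-there v∈) })

inside-⊆ᴾ : {Q : Pred (Fin (suc n)) a} (X : Subset n) → (inside ∷ X) ⊆ᴾ Q ⇔ (Q Fin.zero × X ⊆ᴾ (λ v → Q (Fin.suc v)))
inside-⊆ᴾ X = mk⇔ (λ sub → sub Fin.zero here , λ v v∈X → sub (Fin.suc v) (there v∈X))
                  (λ { (q , sub) Fin.zero _ → q ; (q , sub) (Fin.suc v) v∈ → sub v (drop-there v∈) })

module Degrees {n M} (H : Hypergraph n M) (E : Subset M) where

  PairwiseDisjoint : Set
  PairwiseDisjoint = ∀ e₁ e₂ → e₁ ∈ E → e₂ ∈ E → e₁ ≢ e₂ → Empty (edge H e₁ ∩ edge H e₂)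

  Covering : Set
  Covering = ∀ v → Σ (Fin M) λ e → e ∈ E × v ∈ edge H e

  incident? : ∀ v → Decidable (λ e → e ∈ E × v ∈ edge H e)
  incident? v e = (e ∈? E) ×-dec (v ∈? edge H e)

  deg : Fin n → ℕ
  deg v = count (incident? v)

  -- Double counting of incident (vertex, edge) pairs.
  handshake : ∀ {k} → Uniform k H → ∑[ v < n ] deg v ≡ ∣ E ∣ * k
  handshake {k} uniform = begin
    ∑[ v < n ] ∑[ e < M ] 𝟙 ((e ∈? E) ×-dec (v ∈? edge H e))
      ≡⟨ ∑-comm (λ v e → 𝟙 ((e ∈? E) ×-dec (v ∈? edge H e))) ⟩
    ∑[ e < M ] ∑[ v < n ] 𝟙 ((e ∈? E) ×-dec (v ∈? edge H e))
      ≡⟨ sum-cong-≗ (λ e → sum-cong-≗ (λ v → 𝟙-× (e ∈? E) (v ∈? edge H e))) ⟩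
    ∑[ e < M ] ∑[ v < n ] (𝟙 (e ∈? E) * 𝟙 (v ∈? edge H e))
      ≡⟨ sum-cong-≗ (λ e → sym (*-distribˡ-sum (𝟙 (e ∈? E)) (λ v → 𝟙 (v ∈? edge H e)))) ⟩
    ∑[ e < M ] (𝟙 (e ∈? E) * count (_∈? edge H e))
      ≡⟨ sum-cong-≗ (λ e → cong (𝟙 (e ∈? E) *_) (trans (sym (∣p∣≡count (edge H e))) (uniform e))) ⟩
    ∑[ e < M ] (𝟙 (e ∈? E) * k)
      ≡⟨ sym (*-distribʳ-sum k (λ e → 𝟙 (e ∈? E))) ⟩
    count (_∈? E) * k
      ≡⟨ cong (_* k) (sym (∣p∣≡count E)) ⟩
    ∣ E ∣ * k ∎
    where open ≡-Reasoning

  covered⇒deg≥1 : Covering → ∀ v → 1 ≤ deg v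
  covered⇒deg≥1 covering v = let (e , e∈E , v∈e) = covering v in count-≥1 (incident? v) e (e∈E , v∈e)

  exactCover⇒deg≡1 : IsExactCover H E → ∀ v → deg v ≡ 1
  exactCover⇒deg≡1 (disjoint , covering) v =
    ℕP.≤-antisym (count-≤1 (incident? v) unique) (covered⇒deg≥1 covering v)
    where
    unique : ∀ e₁ e₂ → e₁ ∈ E × v ∈ edge H e₁ → e₂ ∈ E × v ∈ edge H e₂ → e₁ ≡ e₂
    unique e₁ e₂ (e₁∈E , v∈e₁) (e₂∈E , v∈e₂) = decidable-stable (e₁ ≟ᶠ e₂)
      (λ e₁≢e₂ → disjoint e₁ e₂ e₁∈E e₂∈E e₁≢e₂ (v , x∈p∩q⁺ (v∈e₁ , v∈e₂)))

  -- A covering by |E| = n / k edges of size k is automatically disjoint: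
  -- a vertex in two edges would push the degree sum above n.
  tightCover⇒disjoint : ∀ {k} → Uniform k H → Cardinality k H E → Covering → PairwiseDisjoint
  tightCover⇒disjoint uniform card covering e₁ e₂ e₁∈E e₂∈E e₁≢e₂ (w , w∈e₁∩e₂) =
    ℕP.<-irrefl refl (subst (suc n ≤_) (trans (handshake uniform) card)
      (sum-excess deg (covered⇒deg≥1 covering) w
        (count-≥2 (incident? w) e₁ e₂ e₁≢e₂ (e₁∈E , w∈e₁) (e₂∈E , w∈e₂))))
    where
    w∈e₁ : w ∈ edge H e₁
    w∈e₁ = proj₁ (x∈p∩q⁻ _ _ w∈e₁∩e₂)
    w∈e₂ : w ∈ edge H e₂
    w∈e₂ = proj₂ (x∈p∩q⁻ _ _ w∈e₁∩e₂)

module Conditions {n M} (k : ℕ) (H : Hypergraph n M) (U : Subset n) (E : Subset M) where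
  open Degrees H E

  Rest : Set
  Rest = Cardinality k H E × Coverage H U E × Disjointness H U E

  -- Avoidance is vacuous for X = ∅, so W-cond at ∅ decides the remaining conditions.
  rest? : Dec Rest
  rest? = map′ proj₂ (λ rest → avoid-∅ , rest) (W-cond? k H U ⊥ E)
    where
    avoid-∅ : Avoidance H ⊥ E
    avoid-∅ e _ (w , w∈e∩∅) = ∉⊥ (proj₂ (x∈p∩q⁻ _ _ w∈e∩∅))

  Free : Pred (Fin n) 0ℓ
  Free v = v ∉ U × (∀ e → e ∈ E → v ∉ edge H e)

  free? : Decidable Free
  free? v = ¬? (v ∈? U) ×-dec all? (λ e → (e ∈? E) →-dec ¬? (v ∈? edge H e))

  W-cond⇔ : ∀ X → (X ⊆ ∁ U × W-cond k H U X E) ⇔ (Rest × X ⊆ᴾ Free)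
  W-cond⇔ X = mk⇔
    (λ (X⊆∁U , avoid , rest) → rest , λ v v∈X →
       x∈∁p⇒x∉p (X⊆∁U v∈X) , λ e e∈E v∈e → avoid e e∈E (v , x∈p∩q⁺ (v∈e , v∈X)))
    (λ (rest , X⊆free) →
       (λ v∈X → x∉p⇒x∈∁p (proj₁ (X⊆free _ v∈X))) ,
       (λ e e∈E (w , w∈e∩X) → let (w∈e , w∈X) = x∈p∩q⁻ _ _ w∈e∩X in
          proj₂ (X⊆free w w∈X) e e∈E w∈e) ,
       rest)

  noFree⇒covering : Coverage H U E → (∀ v → ¬ Free v) → Covering
  noFree⇒covering coverU noFree v with v ∈? U
  ... | yes v∈U = coverU v v∈U
  ... | no v∉U with any? (incident? v)
  ...   | yes (e , e∈E , v∈e) = e , e∈E , v∈e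
  ...   | no none = ⊥-elim (noFree v (v∉U , λ e e∈E v∈e → none (e , e∈E , v∈e)))

  exactCover⇔ : Uniform k H → (Rest × (∀ v → ¬ Free v)) ⇔ IsExactCover H E
  exactCover⇔ uniform = mk⇔ conditions⇒exact exact⇒conditions
    where
    exact⇒conditions : IsExactCover H E → Rest × (∀ v → ¬ Free v)
    exact⇒conditions exact@(disjoint , covering) =
      ( trans (sym (handshake uniform)) (sum-ones deg (exactCover⇒deg≡1 exact))
      , (λ u _ → covering u)
      , (λ e₁ e₂ e₁∈E e₂∈E e₁≢e₂ (w , w∈) →
           disjoint e₁ e₂ e₁∈E e₂∈E e₁≢e₂ (w , proj₁ (x∈p∩q⁻ _ _ w∈))) )
      , λ v (_ , missed) → let (e , e∈E , v∈e) = covering v in missed e e∈E v∈e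
    conditions⇒exact : Rest × (∀ v → ¬ Free v) → IsExactCover H E
    conditions⇒exact ((card , coverU , _) , noFree) =
      tightCover⇒disjoint uniform card covering , covering
      where
      covering : Covering
      covering = noFree⇒covering coverU noFree

module CharacteristicTwo {c ℓ} (R : CommutativeRing c ℓ) (char2 : RingSums.Char2 R) where
  open CommutativeRing R hiding (zero)
    renaming (_+_ to _+ᴿ_; _*_ to _*ᴿ_; refl to ≈-refl; sym to ≈-sym; trans to ≈-trans)
  open RingSums R
  open import Algebra.Properties.CommutativeSemigroup +-commutativeSemigroup using (interchange)
  open import Relation.Binary.Reasoning.Setoid setoid

  -- It is the summand
  -- of sumWhere (a sum over the single subset of Fin 0), so that
  -- sumWhere P? g is by definition sumAll (λ s → sel (P? s) (g s)).
  sel : {A : Set a} → Dec A → Carrier → Carrier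
  sel {A = A} d x = sumWhere {0} {P = λ _ → A} (λ _ → d) (λ _ → x)

  sel-cong : {A : Set a} (d : Dec A) {x y : Carrier} → x ≈ y → sel d x ≈ sel d y
  sel-cong (yes _) x≈y = x≈y
  sel-cong (no _) _ = ≈-refl

  sel-no : {A : Set a} (d : Dec A) → ¬ A → ∀ x → sel d x ≈ 0#
  sel-no (yes a) ¬a x = ⊥-elim (¬a a)
  sel-no (no _) _ x = ≈-refl

  sel-resp : {A : Set a} {B : Set b} (d : Dec A) (d′ : Dec B) → A ⇔ B → ∀ x → sel d x ≈ sel d′ x
  sel-resp (yes _) (yes _) _ x = ≈-refl
  sel-resp (yes a) (no ¬b) A⇔B x = ⊥-elim (¬b (Equivalence.to A⇔B a))
  sel-resp (no ¬a) (yes b) A⇔B x = ⊥-elim (¬a (Equivalence.from A⇔B b))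
  sel-resp (no _) (no _) _ x = ≈-refl

  sel-× : {A : Set a} {B : Set b} (d : Dec A) (d′ : Dec B) → ∀ x → sel (d ×-dec d′) x ≈ sel d (sel d′ x)
  sel-× (yes _) (yes _) x = ≈-refl
  sel-× (yes _) (no _) x = ≈-refl
  sel-× (no _) d′ x = ≈-refl

  sumAll-cong : ∀ {m} {g h : Subset m → Carrier} → (∀ s → g s ≈ h s) → sumAll g ≈ sumAll h
  sumAll-cong {zero} g≈h = g≈h []
  sumAll-cong {suc m} g≈h = +-cong (sumAll-cong (λ s → g≈h (outside ∷ s))) (sumAll-cong (λ s → g≈h (inside ∷ s)))

  sumAll-0 : ∀ {m} → sumAll {m} (λ _ → 0#) ≈ 0#
  sumAll-0 {zero} = ≈-refl
  sumAll-0 {suc m} = ≈-trans (+-cong (sumAll-0 {m}) (sumAll-0 {m})) (+-identityˡ 0#)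

  sumAll-+ : ∀ {m} (g h : Subset m → Carrier) → sumAll (λ s → g s +ᴿ h s) ≈ sumAll g +ᴿ sumAll h
  sumAll-+ {zero} g h = ≈-refl
  sumAll-+ {suc m} g h = ≈-trans
    (+-cong (sumAll-+ (λ s → g (outside ∷ s)) (λ s → h (outside ∷ s)))
            (sumAll-+ (λ s → g (inside ∷ s)) (λ s → h (inside ∷ s))))
    (interchange _ _ _ _)

  sumAll-swap : ∀ {m p} (G : Subset m → Subset p → Carrier)
    → sumAll (λ X → sumAll (λ Y → G X Y)) ≈ sumAll (λ Y → sumAll (λ X → G X Y))
  sumAll-swap {zero} G = ≈-refl
  sumAll-swap {suc m} G = ≈-trans
    (+-cong (sumAll-swap (λ X → G (outside ∷ X))) (sumAll-swap (λ X → G (inside ∷ X))))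
    (≈-sym (sumAll-+ (λ Y → sumAll (λ X → G (outside ∷ X) Y)) (λ Y → sumAll (λ X → G (inside ∷ X) Y))))

  sel-sumAll : {A : Set a} (d : Dec A) {m : ℕ} (g : Subset m → Carrier)
    → sel d (sumAll g) ≈ sumAll (λ s → sel d (g s))
  sel-sumAll (yes _) g = ≈-refl
  sel-sumAll (no _) {m} g = ≈-sym (sumAll-0 {m})

  double≈0 : ∀ y → y +ᴿ y ≈ 0#
  double≈0 y = begin
    y +ᴿ y              ≈⟨ +-cong (*-identityˡ y) (*-identityˡ y) ⟨
    1# *ᴿ y +ᴿ 1# *ᴿ y  ≈⟨ distribʳ y 1# 1# ⟨
    (1# +ᴿ 1#) *ᴿ y     ≈⟨ *-congʳ char2 ⟩
    0# *ᴿ y             ≈⟨ zeroˡ y ⟩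
    0#                  ∎

  -- In characteristic 2, Σ_{X ⊆ Q} x = [Q = ∅]·x.  Splitting off the first vertex:
  -- if it lies in Q, the subsets with and without it give equal sums, which cancel.
  sumAll-⊆ᴾ : ∀ {n} {Q : Pred (Fin n) a} (Q? : Decidable Q) x
    → sumAll (λ X → sel (X ⊆ᴾ? Q?) x) ≈ sel (all? (λ v → ¬? (Q? v))) x
  sumAll-⊆ᴾ {n = zero} Q? x = sel-resp ([] ⊆ᴾ? Q?) (all? (λ v → ¬? (Q? v))) (mk⇔ (λ _ ()) (λ _ _ ())) x
  sumAll-⊆ᴾ {n = suc n} {Q = Q} Q? x = begin
    sumAll (λ X → sel ((outside ∷ X) ⊆ᴾ? Q?) x) +ᴿ sumAll (λ X → sel ((inside ∷ X) ⊆ᴾ? Q?) x)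
      ≈⟨ +-cong (sumAll-cong (λ X → sel-resp ((outside ∷ X) ⊆ᴾ? Q?) (X ⊆ᴾ? Q?′) (outside-⊆ᴾ X) x))
                (sumAll-cong (λ X → ≈-trans (sel-resp ((inside ∷ X) ⊆ᴾ? Q?) (Q? Fin.zero ×-dec X ⊆ᴾ? Q?′) (inside-⊆ᴾ X) x)
                                            (sel-× (Q? Fin.zero) (X ⊆ᴾ? Q?′) x))) ⟩
    sumAll (λ X → sel (X ⊆ᴾ? Q?′) x) +ᴿ sumAll (λ X → sel (Q? Fin.zero) (sel (X ⊆ᴾ? Q?′) x))
      ≈⟨ +-congˡ (sel-sumAll (Q? Fin.zero) (λ X → sel (X ⊆ᴾ? Q?′) x)) ⟨
    sumAll (λ X → sel (X ⊆ᴾ? Q?′) x) +ᴿ sel (Q? Fin.zero) (sumAll (λ X → sel (X ⊆ᴾ? Q?′) x))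
      ≈⟨ +-cong (sumAll-⊆ᴾ Q?′ x) (sel-cong (Q? Fin.zero) (sumAll-⊆ᴾ Q?′ x)) ⟩
    sel none′? x +ᴿ sel (Q? Fin.zero) (sel none′? x)
      ≈⟨ split-first (Q? Fin.zero) ⟩
    sel (all? (λ v → ¬? (Q? v))) x ∎
    where
    Q?′ : Decidable (λ v → Q (Fin.suc v))
    Q?′ v = Q? (Fin.suc v)
    none′? : Dec (∀ v → ¬ Q (Fin.suc v))
    none′? = all? (λ v → ¬? (Q?′ v))
    split-first : (q? : Dec (Q Fin.zero))
      → sel none′? x +ᴿ sel q? (sel none′? x) ≈ sel (all? (λ v → ¬? (Q? v))) x
    split-first (yes q) = ≈-trans (double≈0 _) (≈-sym (sel-no (all? (λ v → ¬? (Q? v))) (λ none → none Fin.zero q) x))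
    split-first (no ¬q) = ≈-trans (+-identityʳ _) (sel-resp none′? (all? (λ v → ¬? (Q? v)))
      (mk⇔ (λ { none′ Fin.zero → ¬q ; none′ (Fin.suc v) → none′ v }) (λ none v → none (Fin.suc v))) x)

  sel-resp-× : {A : Set a} {B : Set b} {C : Set c′} {D : Set d′}
    (dA : Dec A) (dB : Dec B) (dC : Dec C) (dD : Dec D)
    → (A × B) ⇔ (C × D) → ∀ x → sel dA (sel dB x) ≈ sel dC (sel dD x)
  sel-resp-× dA dB dC dD equiv x = begin
    sel dA (sel dB x)    ≈⟨ sel-× dA dB x ⟨
    sel (dA ×-dec dB) x  ≈⟨ sel-resp (dA ×-dec dB) (dC ×-dec dD) equiv x ⟩
    sel (dC ×-dec dD) x  ≈⟨ sel-× dC dD x ⟩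
    sel dC (sel dD x)    ∎

  -- For a fixed edge set E, summing the W-condition over X ⊆ V ∖ U leaves
  -- exactly the exact-cover indicator: the admissible X are the subsets of the
  -- free vertices, and these cancel unless there are none.
  sum-over-X : ∀ {n M} (k : ℕ) (H : Hypergraph n M) → Uniform k H → (U : Subset n) (E : Subset M)
    → ∀ x → sumAll (λ X → sel (X ⊆? ∁ U) (sel (W-cond? k H U X E) x)) ≈ sel (exactCover? H E) x
  sum-over-X k H uniform U E x = begin
    sumAll (λ X → sel (X ⊆? ∁ U) (sel (W-cond? k H U X E) x))
      ≈⟨ sumAll-cong (λ X → sel-resp-× (X ⊆? ∁ U) (W-cond? k H U X E) rest? (X ⊆ᴾ? free?) (W-cond⇔ X) x) ⟩
    sumAll (λ X → sel rest? (sel (X ⊆ᴾ? free?) x))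
      ≈⟨ sel-sumAll rest? (λ X → sel (X ⊆ᴾ? free?) x) ⟨
    sel rest? (sumAll (λ X → sel (X ⊆ᴾ? free?) x))
      ≈⟨ sel-cong rest? (sumAll-⊆ᴾ free? x) ⟩
    sel rest? (sel (all? (λ v → ¬? (free? v))) x)
      ≈⟨ sel-× rest? (all? (λ v → ¬? (free? v))) x ⟨
    sel (rest? ×-dec all? (λ v → ¬? (free? v))) x
      ≈⟨ sel-resp (rest? ×-dec all? (λ v → ¬? (free? v))) (exactCover? H E) (exactCover⇔ uniform) x ⟩
    sel (exactCover? H E) x ∎
    where open Conditions k H U E

-- Lemma 2.4.
lemma2p4 : ∀ {c ℓ} (R : CommutativeRing c ℓ) → RingSums.Char2 R
  → ∀ {n M} (k : ℕ) (H : Hypergraph n M) → Uniform k H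
  → (f : Fin M → ℕ) → (∀ e → 1 ≤ f e)
  → (v : Fin M → CommutativeRing.Carrier R)
  → (U : Subset n)
  → CommutativeRing._≈_ R
      (RingSums.sumSubsetsOf R (∁ U) (RingSums.W₂ R k H v f U))
      (RingSums.sumWhere R (exactCover? H) (RingSums.monomial R v f))
lemma2p4 R char2 {M = M} k H uniform f _ v U = begin
  sumSubsetsOf (∁ U) (W₂ k H v f U)
    ≡⟨⟩
  sumAll (λ X → sel (X ⊆? ∁ U) (sumAll (λ E → sel (W-cond? k H U X E) (mon E))))
    ≈⟨ sumAll-cong (λ X → sel-sumAll (X ⊆? ∁ U) (λ E → sel (W-cond? k H U X E) (mon E))) ⟩
  sumAll (λ X → sumAll (λ E → sel (X ⊆? ∁ U) (sel (W-cond? k H U X E) (mon E))))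
    ≈⟨ sumAll-swap (λ X E → sel (X ⊆? ∁ U) (sel (W-cond? k H U X E) (mon E))) ⟩
  sumAll (λ E → sumAll (λ X → sel (X ⊆? ∁ U) (sel (W-cond? k H U X E) (mon E))))
    ≈⟨ sumAll-cong (λ E → sum-over-X k H uniform U E (mon E)) ⟩
  sumAll (λ E → sel (exactCover? H E) (mon E))
    ≡⟨⟩
  sumWhere (exactCover? H) (monomial v f) ∎
  where
  open CommutativeRing R using (setoid)
  open RingSums R
  open CharacteristicTwo R char2
  open import Relation.Binary.Reasoning.Setoid setoid
  mon : Subset M → CommutativeRing.Carrier R
  mon = monomial v f
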